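{- The complement of every (finite) disjoint union of paths is $1$-perfectly orientable.
   Context: All graphs are finite and simple. An orientation of a graph $G$ is $1$-perfect if for every vertex $v$, its out-neighborhood is a clique in $G$; $G$ is $1$-perfectly orientable if it admits a $1$-perfect orientation. -}

module Defs where

open import Data.Nat using (ℕ; suc)
open import Data.Fin using (Fin; toℕ)
open import Data.List using (List; length; lookup)
open import Data.Product using (Σ; _×_; ∃)
open import Data.Sum using (_⊎_)
open import Relation.Nullary using (¬_)
open import Relation.Binary.PropositionalEquality using (_≡_; _≢_)
open import Function.Bundles using (_↔_; _⇔_; Inverse)
open import Level using (0ℓ)

record Graph : Set₁ where
  field
    n     : ℕ
    Adj   : Fin n → Fin n → Set
    irrefl : ∀ v → ¬ Adj v v
    sym   : ∀ {u v} → Adj u v → Adj v u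
open Graph public

complement : Graph → Graph
complement G = record
  { n = n G
  ; Adj = λ u v → u ≢ v × ¬ Adj G u v
  ; irrefl = λ v p → Data.Product.proj₁ p _≡_.refl
  ; sym = λ { (u≢v , ¬a) → (λ e → u≢v (Relation.Binary.PropositionalEquality.sym e))
                         , (λ a → ¬a (Graph.sym G a)) }
  }
  where open import Data.Product using (_,_; proj₁)

record Orientation (G : Graph) : Set₁ where
  field
    Arc      : Fin (n G) → Fin (n G) → Set
    arc-edge : ∀ {u v} → Arc u v → Adj G u v
    total    : ∀ {u v} → Adj G u v → Arc u v ⊎ Arc v u
    antisym  : ∀ {u v} → Arc u v → ¬ Arc v u
open Orientation public

Is1Perfect : {G : Graph} → Orientation G → Set
Is1Perfect {G} O = ∀ {v x y} → Arc O v x → Arc O v y → x ≢ y → Adj G x y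

OnePerfectlyOrientable : Graph → Set₁
OnePerfectlyOrientable G = Σ (Orientation G) Is1Perfect

-- The disjoint union of paths P_{ℓ₁} + … + P_{ℓ_k}, given by the list of
-- numbers of vertices ℓᵢ: vertices are pairs (i , j) with j < ℓᵢ, and
-- (i , j) ~ (i' , j') iff i = i' and |j - j'| = 1.
PathsVertex : List ℕ → Set
PathsVertex ls = Σ (Fin (length ls)) (λ i → Fin (lookup ls i))

PathsAdj : (ls : List ℕ) → PathsVertex ls → PathsVertex ls → Set
PathsAdj ls (i Data.Product., j) (i' Data.Product., j') =
  i ≡ i' × (suc (toℕ j) ≡ toℕ j' ⊎ suc (toℕ j') ≡ toℕ j)

IsDisjointUnionOfPaths : Graph → Set
IsDisjointUnionOfPaths G =
  Σ (List ℕ) λ ls →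
  Σ (Fin (n G) ↔ PathsVertex ls) λ f →
    ∀ u v → Adj G u v ⇔ PathsAdj ls (Inverse.to f u) (Inverse.to f v)

-- Place the vertices in ℕ × ℕ, ordered lexicographically, so that every edge of the paths joins
-- a position (a , b) to its immediate successor (a , 1 + b). In the complement, let v point
-- forward to the vertices whose second coordinate has the other parity and backward to those
-- with the same parity. The two ends of a path edge have different parities, so if v pointed to
-- both, either v would lie after the later end and before the earlier one, or strictly between
-- two lexicographic neighbours. Hence no out-neighbourhood contains an edge of the paths, i.e.
-- every out-neighbourhood is a clique in the complement.
module Submission where

open import Defs hiding (sym)
open import Data.Nat using (ℕ; suc; _<_; s≤s; parity)
open import Data.Nat.Properties using (<-isStrictTotalOrder; <-irrefl; <-asym; n<1+n; <-≤-trans)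
open import Data.Parity using (Parity; 0ℙ; 1ℙ; _⁻¹) renaming (_≟_ to _≟ℙ_)
open import Data.Parity.Properties using (p≢p⁻¹; suc-homo-⁻¹; ⁻¹-selfInverse)
open import Data.Fin using (Fin; toℕ)
open import Data.Fin.Properties using (toℕ-injective)
open import Data.Product using (_×_; _,_; proj₁; proj₂)
open import Data.Product.Relation.Binary.Lex.Strict using (×-Lex; ×-isStrictTotalOrder)
open import Data.Product.Relation.Binary.Pointwise.NonDependent using (≡×≡⇒≡)
open import Data.Empty using (⊥-elim)
open import Data.Sum using (_⊎_; inj₁; inj₂; [_,_])
import Data.Sum as Sum
open import Data.List using (List)
open import Function using (_∘_)
open import Function.Bundles using (Inverse; Injection; Equivalence)
open import Function.Definitions using (Injective)
open import Function.Properties.Inverse using (Inverse⇒Injection)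
open import Relation.Nullary using (¬_; yes; no)
open import Relation.Binary using (Rel; IsStrictTotalOrder; tri<; tri≈; tri>)
open import Relation.Binary.PropositionalEquality using (_≡_; _≢_; refl; sym; cong; trans)
open import Level using (0ℓ)

Position : Set
Position = ℕ × ℕ

_<ₗₑₓ_ : Rel Position 0ℓ
_<ₗₑₓ_ = ×-Lex _≡_ _<_ _<_

<ₗₑₓ-isStrictTotalOrder : IsStrictTotalOrder _ _<ₗₑₓ_
<ₗₑₓ-isStrictTotalOrder = ×-isStrictTotalOrder <-isStrictTotalOrder <-isStrictTotalOrder

open IsStrictTotalOrder <ₗₑₓ-isStrictTotalOrder using (compare) renaming (trans to <ₗₑₓ-trans; asym to <ₗₑₓ-asym)

_⋖_ : Rel Position 0ℓ
(a , b) ⋖ (c , d) = a ≡ c × suc b ≡ d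

⋖⇒<ₗₑₓ : ∀ {p q} → p ⋖ q → p <ₗₑₓ q
⋖⇒<ₗₑₓ {_ , b} (refl , refl) = inj₂ (refl , n<1+n b)

⋖-covers : ∀ {p q r} → p ⋖ r → p <ₗₑₓ q → ¬ q <ₗₑₓ r
⋖-covers (refl , refl) (inj₁ p<q)          (inj₁ q<r)           = <-asym p<q q<r
⋖-covers (refl , refl) (inj₁ p<q)          (inj₂ (refl , _))    = <-irrefl refl p<q
⋖-covers (refl , refl) (inj₂ (refl , _))   (inj₁ q<r)           = <-irrefl refl q<r
⋖-covers (refl , refl) (inj₂ (refl , p<q)) (inj₂ (_ , s≤s q<r)) = <-irrefl refl (<-≤-trans p<q q<r)

π : Position → Parity
π (_ , b) = parity b

⋖-flips-π : ∀ {p q} → p ⋖ q → π q ≡ π p ⁻¹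
⋖-flips-π {_ , b} (refl , refl) = sym (⁻¹-selfInverse (suc-homo-⁻¹ b))

≢⇒≡⁻¹ : ∀ {p q : Parity} → p ≢ q → p ≡ q ⁻¹
≢⇒≡⁻¹ {0ℙ} {0ℙ} p≢q = ⊥-elim (p≢q refl)
≢⇒≡⁻¹ {0ℙ} {1ℙ} _   = refl
≢⇒≡⁻¹ {1ℙ} {0ℙ} _   = refl
≢⇒≡⁻¹ {1ℙ} {1ℙ} p≢q = ⊥-elim (p≢q refl)

_⇝_ : Rel Position 0ℓ
p ⇝ q = (p <ₗₑₓ q × π p ≢ π q) ⊎ (q <ₗₑₓ p × π p ≡ π q)

⇝-total : ∀ {p q} → p ≢ q → p ⇝ q ⊎ q ⇝ p
⇝-total {p} {q} p≢q with compare p q | π p ≟ℙ π q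
... | tri< p<q _ _ | no  πp≢πq = inj₁ (inj₁ (p<q , πp≢πq))
... | tri< p<q _ _ | yes πp≡πq = inj₂ (inj₂ (p<q , sym πp≡πq))
... | tri> _ _ q<p | no  πp≢πq = inj₂ (inj₁ (q<p , πp≢πq ∘ sym))
... | tri> _ _ q<p | yes πp≡πq = inj₁ (inj₂ (q<p , πp≡πq))
... | tri≈ _ p≈q _ | _         = ⊥-elim (p≢q (≡×≡⇒≡ p≈q))

⇝-asym : ∀ {p q} → p ⇝ q → ¬ q ⇝ p
⇝-asym (inj₁ (p<q , _))     (inj₁ (q<p , _))     = <ₗₑₓ-asym p<q q<p
⇝-asym (inj₁ (_ , πp≢πq))   (inj₂ (_ , πq≡πp))   = πp≢πq (sym πq≡πp)
⇝-asym (inj₂ (_ , πp≡πq))   (inj₁ (_ , πq≢πp))   = πq≢πp (sym πp≡πq)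
⇝-asym (inj₂ (q<p , _))     (inj₂ (p<q , _))     = <ₗₑₓ-asym p<q q<p

⇝-avoids-⋖ : ∀ {v p q} → p ⋖ q → v ⇝ p → ¬ v ⇝ q
⇝-avoids-⋖ {v} {p} {q} p⋖q = avoid
  where
  πq≡πp⁻¹ : π q ≡ π p ⁻¹
  πq≡πp⁻¹ = ⋖-flips-π p⋖q

  avoid : v ⇝ p → ¬ v ⇝ q
  avoid (inj₁ (_ , πv≢πp))   (inj₁ (_ , πv≢πq))   = πv≢πq (trans (≢⇒≡⁻¹ πv≢πp) (sym πq≡πp⁻¹))
  avoid (inj₂ (_ , πv≡πp))   (inj₂ (_ , πv≡πq))   = p≢p⁻¹ (π p) (trans (sym πv≡πp) (trans πv≡πq πq≡πp⁻¹))
  avoid (inj₁ (v<p , _))     (inj₂ (q<v , _))     = <ₗₑₓ-asym (⋖⇒<ₗₑₓ p⋖q) (<ₗₑₓ-trans q<v v<p)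
  avoid (inj₂ (p<v , _))     (inj₁ (v<q , _))     = ⋖-covers p⋖q p<v v<q

complement-onePerfectlyOrientable :
  (G : Graph) (pos : Fin (n G) → Position) → Injective _≡_ _≡_ pos →
  (∀ {u v} → Adj G u v → pos u ⋖ pos v ⊎ pos v ⋖ pos u) →
  OnePerfectlyOrientable (complement G)
complement-onePerfectlyOrientable G pos pos-injective adj⇒⋖ = orientation , one-perfect
  where
  orientation : Orientation (complement G)
  orientation = record
    { Arc      = λ u v → Adj (complement G) u v × pos u ⇝ pos v
    ; arc-edge = proj₁
    ; total    = λ uv → Sum.map (uv ,_) (Graph.sym (complement G) uv ,_)
                                (⇝-total (proj₁ uv ∘ pos-injective))
    ; antisym  = λ (_ , u⇝v) (_ , v⇝u) → ⇝-asym u⇝v v⇝u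
    }

  one-perfect : Is1Perfect orientation
  one-perfect (_ , v⇝x) (_ , v⇝y) x≢y = x≢y , λ xy →
    [ (λ x⋖y → ⇝-avoids-⋖ x⋖y v⇝x v⇝y) , (λ y⋖x → ⇝-avoids-⋖ y⋖x v⇝y v⇝x) ] (adj⇒⋖ xy)

pathsPosition : (ls : List ℕ) → PathsVertex ls → Position
pathsPosition _ (i , j) = toℕ i , toℕ j

pathsPosition-injective : ∀ ls → Injective _≡_ _≡_ (pathsPosition ls)
pathsPosition-injective _ {i , _} e with toℕ-injective (cong proj₁ e)
... | refl = cong (i ,_) (toℕ-injective (cong proj₂ e))

pathsAdj⇒⋖ : ∀ ls {x y} → PathsAdj ls x y →
             pathsPosition ls x ⋖ pathsPosition ls y ⊎ pathsPosition ls y ⋖ pathsPosition ls x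
pathsAdj⇒⋖ _ {_ , _} {_ , _} (refl , inj₁ j+1≡j′) = inj₁ (refl , j+1≡j′)
pathsAdj⇒⋖ _ {_ , _} {_ , _} (refl , inj₂ j′+1≡j) = inj₂ (refl , j′+1≡j)

corollary12 : (G : Graph) → IsDisjointUnionOfPaths G → OnePerfectlyOrientable (complement G)
corollary12 G (ls , f , adj) =
  complement-onePerfectlyOrientable G (pathsPosition ls ∘ Inverse.to f)
    (Injection.injective (Inverse⇒Injection f) ∘ pathsPosition-injective ls)
    (pathsAdj⇒⋖ ls ∘ Equivalence.to (adj _ _))
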